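{- For any $\gamma\in\mathbb Z^\ell$ and $i\in[\ell-1]$, $g_\gamma-g_{\gamma-\epsilon_{i+1}}=g_{s_i\gamma-\epsilon_i}-g_{s_i\gamma+\epsilon_{i+1}-\epsilon_i}$. Equivalently, $g\circ(1-1/z_{i+1})(1+\frac{z_{i+1}}{z_i}s_i)=0$ as a map $\mathbb A\to\Lambda$.
   Context: $h_d$ are the complete homogeneous symmetric functions ($h_0=1$, $h_d=0$ for $d<0$). For $m,r\in\mathbb Z$, $k^{(r)}_m=\sum_{i=0}^m\binom{r+i-1}{i}h_{m-i}$ ($\binom n0=1$, $\binom ni=n(n-1)\cdots(n-i+1)/i!$). For $\gamma\in\mathbb Z^\ell$, $g_\gamma=\det(k^{(i-1)}_{\gamma_i+j-i})_{1\le i,j\le\ell}$. $\epsilon_i$ is the $i$-th unit vector and $s_i\gamma$ swaps entries $i,i+1$ of $\gamma$. $\mathbb A=\mathbb Z[[z_1/z_2,\dots,z_{\ell-1}/z_\ell]][z_1^{\pm1},\dots,z_\ell^{\pm1}]$, $g:\mathbb A\to\Lambda$ is the additive map $\sum c_\gamma\mathbf z^\gamma\mapsto\sum c_\gamma g_\gamma$, and $s_i$ acts on $\mathbb A$ by $\mathbf z^\gamma\mapsto\mathbf z^{s_i\gamma}$. -}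

module Defs where

open import Algebra.Bundles using (CommutativeRing)
open import Data.Nat as ℕ using (ℕ; zero; suc; _!)
open import Data.Nat.Properties using (_!≢0)
open import Data.Integer as ℤ using (ℤ; +_; -[1+_])
open import Data.Integer.DivMod using (_/ℕ_)
open import Data.Fin using (Fin; zero; suc; toℕ; punchIn; _≟_)
open import Relation.Nullary using (yes; no)

fallingℤ : ℤ → ℕ → ℤ
fallingℤ n zero    = + 1
fallingℤ n (suc i) = n ℤ.* fallingℤ (n ℤ.- + 1) i

binomℤ : ℤ → ℕ → ℤ
binomℤ n i = (fallingℤ n i /ℕ (i !)) {{i !≢0}}

-- Vector updates on γ ∈ ℤ^n (indices 0-based).
-- bump a d γ = γ + d·ε_a
bump : ∀ {n} → Fin n → ℤ → (Fin n → ℤ) → Fin n → ℤ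
bump a d γ k with k ≟ a
... | yes _ = γ k ℤ.+ d
... | no _  = γ k

swapAt : ∀ {n} → Fin n → Fin n → (Fin n → ℤ) → Fin n → ℤ
swapAt a b γ k with k ≟ a | k ≟ b
... | yes _ | _     = γ b
... | no _  | yes _ = γ a
... | no _  | no _  = γ k

-- Everything below is relative to a commutative ring R and a sequence h_0, h_1, …
-- playing the role of the complete homogeneous symmetric functions.
module G {c ℓ} (R : CommutativeRing c ℓ) (h : ℕ → CommutativeRing.Carrier R) where
  open CommutativeRing R hiding (zero)

  natR : ℕ → Carrier
  natR zero    = 0#
  natR (suc n) = 1# + natR n

  intR : ℤ → Carrier
  intR (+ n)      = natR n
  intR -[1+ n ]   = - natR (suc n)

  sumTo : ℕ → (ℕ → Carrier) → Carrier
  sumTo zero    f = f 0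
  sumTo (suc n) f = sumTo n f + f (suc n)

  sumFin : ∀ n → (Fin n → Carrier) → Carrier
  sumFin zero    f = 0#
  sumFin (suc n) f = f zero + sumFin n (λ j → f (suc j))

  signR : ℕ → Carrier
  signR zero    = 1#
  signR (suc k) = - signR k

  det : ∀ n → (Fin n → Fin n → Carrier) → Carrier
  det zero    A = 1#
  det (suc n) A =
    sumFin (suc n) (λ j → signR (toℕ j) * (A zero j * det n (λ a b → A (suc a) (punchIn j b))))

  kk : ℤ → ℤ → Carrier
  kk r (+ m)     = sumTo m (λ i → intR (binomℤ (r ℤ.+ + i ℤ.- + 1) i) * h (m ℕ.∸ i))
  kk r -[1+ _ ]  = 0#

  -- g_γ = det( k^{(i-1)}_{γ_i + j - i} ), written with 0-based indices i, j
  g : ∀ {n} → (Fin n → ℤ) → Carrier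
  g {n} γ = det n (λ i j → kk (+ toℕ i) (γ i ℤ.+ + toℕ j ℤ.- + toℕ i))

-- Pascal's rule k^{(r+1)}_m - k^{(r+1)}_{m-1} = k^{(r)}_m and linearity of the determinant in
-- row i+1 give g_γ - g_{γ-ε_{i+1}} = det L(γ), where L(γ) is the matrix of g_γ with the superscript
-- of row i+1 lowered from i to i-1 (1-based). Rows i and i+1 of L(γ) then share the superscript
-- i-1, so exchanging them yields L(δ) for δ = s_i γ - ε_i + ε_{i+1}, whence det L(γ) = -det L(δ).
-- Applying the first step to δ, whose ε_{i+1}-lowering is s_i γ - ε_i, closes the identity.
module Submission where

open import Defs
open import Algebra.Bundles using (CommutativeRing)
open import Data.Nat as ℕ using (ℕ; zero; suc; _!)
import Data.Nat.Properties as ℕP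
open import Data.Nat.Combinatorics using (_C_; nCk+nC[k+1]≡[n+1]C[k+1])
open import Data.Nat.DivMod using (m*n/n≡m)
import Data.Nat.Tactic.RingSolver as ℕSolver
import Data.Integer.Properties as ℤP
open import Data.Integer as ℤ using (ℤ; +_; -[1+_])
import Data.Integer.Tactic.RingSolver as ℤSolver
open import Data.Fin as F using (Fin; zero; suc; toℕ; punchIn; punchOut; inject₁)
import Data.Fin.Properties as FP
open import Data.Vec.Functional using (Vector; updateAt)
open import Data.Vec.Functional.Properties using (updateAt-updates; updateAt-minimal)
open import Function using (_∘_)
open import Relation.Binary.PropositionalEquality as P using (_≡_; _≢_; _≗_)
open import Relation.Nullary using (Dec; yes; no)
open import Data.Empty using (⊥-elim)

+suc-1≡+ : ∀ t → + suc t ℤ.- + 1 ≡ + t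
+suc-1≡+ t = lemma (+ t)
  where
  lemma : ∀ x → (+ 1 ℤ.+ x) ℤ.- + 1 ≡ x
  lemma = ℤSolver.solve-∀

fallingℤ-suc : ∀ x i → fallingℤ x (suc i) ≡ fallingℤ x i ℤ.* (x ℤ.- + i)
fallingℤ-suc x zero = lemma x
  where
  lemma : ∀ x → x ℤ.* + 1 ≡ + 1 ℤ.* (x ℤ.- + 0)
  lemma = ℤSolver.solve-∀
fallingℤ-suc x (suc i) rewrite fallingℤ-suc (x ℤ.- + 1) i = lemma x (fallingℤ (x ℤ.- + 1) i) (+ i)
  where
  lemma : ∀ x f i → x ℤ.* (f ℤ.* (x ℤ.- + 1 ℤ.- i)) ≡ x ℤ.* f ℤ.* (x ℤ.- (+ 1 ℤ.+ i))
  lemma = ℤSolver.solve-∀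

fallingℤ-pascal : ∀ x i → fallingℤ (+ 1 ℤ.+ x) (suc i) ≡ fallingℤ x (suc i) ℤ.+ + suc i ℤ.* fallingℤ x i
fallingℤ-pascal x i = begin
  (+ 1 ℤ.+ x) ℤ.* fallingℤ (+ 1 ℤ.+ x ℤ.- + 1) i            ≡⟨ P.cong (λ y → (+ 1 ℤ.+ x) ℤ.* fallingℤ y i) (1+x-1≡x x) ⟩
  (+ 1 ℤ.+ x) ℤ.* fallingℤ x i                              ≡⟨ lemma x (fallingℤ x i) (+ i) ⟩
  fallingℤ x i ℤ.* (x ℤ.- + i) ℤ.+ + suc i ℤ.* fallingℤ x i ≡⟨ P.cong (ℤ._+ + suc i ℤ.* fallingℤ x i) (fallingℤ-suc x i) ⟨
  fallingℤ x (suc i) ℤ.+ + suc i ℤ.* fallingℤ x i           ∎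
  where
  open P.≡-Reasoning
  1+x-1≡x : ∀ x → + 1 ℤ.+ x ℤ.- + 1 ≡ x
  1+x-1≡x = ℤSolver.solve-∀
  lemma : ∀ x f i → (+ 1 ℤ.+ x) ℤ.* f ≡ f ℤ.* (x ℤ.- i) ℤ.+ (+ 1 ℤ.+ i) ℤ.* f
  lemma = ℤSolver.solve-∀

fallingℤ-ℕ : ∀ n i → fallingℤ (+ n) i ≡ + ((n C i) ℕ.* i !)
fallingℤ-ℕ n       zero    = P.refl
fallingℤ-ℕ zero    (suc i) = P.refl
fallingℤ-ℕ (suc n) (suc i) = begin
  fallingℤ (+ 1 ℤ.+ + n) (suc i)                            ≡⟨ fallingℤ-pascal (+ n) i ⟩
  fallingℤ (+ n) (suc i) ℤ.+ + suc i ℤ.* fallingℤ (+ n) i   ≡⟨ P.cong₂ (λ u v → u ℤ.+ + suc i ℤ.* v)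
                                                                  (fallingℤ-ℕ n (suc i)) (fallingℤ-ℕ n i) ⟩
  + a ℤ.+ + suc i ℤ.* + b                                   ≡⟨ P.trans (ℤP.pos-+ a (suc i ℕ.* b))
                                                                  (P.cong (λ z → + a ℤ.+ z) (ℤP.pos-* (suc i) b)) ⟨
  + (a ℕ.+ suc i ℕ.* b)                                     ≡⟨ P.cong +_ (lemma (n C suc i) (n C i) (i !) i) ⟩
  + ((n C i ℕ.+ n C suc i) ℕ.* (suc i) !)                   ≡⟨ P.cong (λ c → + (c ℕ.* (suc i) !))
                                                                  (nCk+nC[k+1]≡[n+1]C[k+1] n i) ⟩
  + ((suc n C suc i) ℕ.* (suc i) !)                           ∎
  where
  open P.≡-Reasoning
  a = (n C suc i) ℕ.* (suc i) !
  b = (n C i) ℕ.* i !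
  lemma : ∀ a b f i → a ℕ.* (f ℕ.+ i ℕ.* f) ℕ.+ suc i ℕ.* (b ℕ.* f) ≡ (b ℕ.+ a) ℕ.* (f ℕ.+ i ℕ.* f)
  lemma = ℕSolver.solve-∀

binomℤ-ℕ : ∀ n i → binomℤ (+ n) i ≡ + (n C i)
binomℤ-ℕ n i rewrite fallingℤ-ℕ n i = P.cong +_ (m*n/n≡m (n C i) (i !) {{ℕP._!≢0 i}})

bump-updates : ∀ {n} {a k : Fin n} d γ → k ≡ a → bump a d γ k ≡ γ k ℤ.+ d
bump-updates {a = a} {k} d γ k≡a with k F.≟ a
... | yes _   = P.refl
... | no k≢a = ⊥-elim (k≢a k≡a)

bump-minimal : ∀ {n} {a k : Fin n} d γ → k ≢ a → bump a d γ k ≡ γ k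
bump-minimal {a = a} {k} d γ k≢a with k F.≟ a
... | yes k≡a = ⊥-elim (k≢a k≡a)
... | no _    = P.refl

bump-conjugate : ∀ {n} (a b : Fin n) d e γ → bump b (ℤ.- d) (bump a e (bump b d γ)) ≗ bump a e γ
bump-conjugate a b d e γ k = cases (k F.≟ b) (k F.≟ a)
  where
  open P.≡-Reasoning
  cases : Dec (k ≡ b) → Dec (k ≡ a) → bump b (ℤ.- d) (bump a e (bump b d γ)) k ≡ bump a e γ k
  cases (yes k≡b) (yes k≡a) = begin
    bump b (ℤ.- d) (bump a e (bump b d γ)) k ≡⟨ bump-updates _ _ k≡b ⟩
    bump a e (bump b d γ) k ℤ.+ ℤ.- d        ≡⟨ P.cong (ℤ._+ ℤ.- d) (bump-updates e _ k≡a) ⟩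
    bump b d γ k ℤ.+ e ℤ.+ ℤ.- d             ≡⟨ P.cong (λ z → z ℤ.+ e ℤ.+ ℤ.- d) (bump-updates d γ k≡b) ⟩
    γ k ℤ.+ d ℤ.+ e ℤ.+ ℤ.- d                ≡⟨ lemma (γ k) d e ⟩
    γ k ℤ.+ e                                ≡⟨ bump-updates e γ k≡a ⟨
    bump a e γ k                             ∎
    where
    lemma : ∀ x d e → x ℤ.+ d ℤ.+ e ℤ.+ ℤ.- d ≡ x ℤ.+ e
    lemma = ℤSolver.solve-∀
  cases (yes k≡b) (no k≢a) = begin
    bump b (ℤ.- d) (bump a e (bump b d γ)) k ≡⟨ bump-updates _ _ k≡b ⟩
    bump a e (bump b d γ) k ℤ.+ ℤ.- d        ≡⟨ P.cong (ℤ._+ ℤ.- d) (bump-minimal e _ k≢a) ⟩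
    bump b d γ k ℤ.+ ℤ.- d                   ≡⟨ P.cong (ℤ._+ ℤ.- d) (bump-updates d γ k≡b) ⟩
    γ k ℤ.+ d ℤ.+ ℤ.- d                      ≡⟨ lemma (γ k) d ⟩
    γ k                                      ≡⟨ bump-minimal e γ k≢a ⟨
    bump a e γ k                             ∎
    where
    lemma : ∀ x d → x ℤ.+ d ℤ.+ ℤ.- d ≡ x
    lemma = ℤSolver.solve-∀
  cases (no k≢b) (yes k≡a) = begin
    bump b (ℤ.- d) (bump a e (bump b d γ)) k ≡⟨ bump-minimal _ _ k≢b ⟩
    bump a e (bump b d γ) k                  ≡⟨ bump-updates e _ k≡a ⟩
    bump b d γ k ℤ.+ e                       ≡⟨ P.cong (ℤ._+ e) (bump-minimal d γ k≢b) ⟩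
    γ k ℤ.+ e                                ≡⟨ bump-updates e γ k≡a ⟨
    bump a e γ k                             ∎
  cases (no k≢b) (no k≢a) = begin
    bump b (ℤ.- d) (bump a e (bump b d γ)) k ≡⟨ bump-minimal _ _ k≢b ⟩
    bump a e (bump b d γ) k                  ≡⟨ bump-minimal e _ k≢a ⟩
    bump b d γ k                             ≡⟨ bump-minimal d γ k≢b ⟩
    γ k                                      ≡⟨ bump-minimal e γ k≢a ⟨
    bump a e γ k                             ∎

swapAt-first : ∀ {n} (a b : Fin n) γ → swapAt a b γ a ≡ γ b
swapAt-first a b γ with a F.≟ a
... | yes _  = P.refl
... | no a≢a = ⊥-elim (a≢a P.refl)

swapAt-second : ∀ {n} {a b : Fin n} γ → a ≢ b → swapAt a b γ b ≡ γ a
swapAt-second {a = a} {b} γ a≢b with b F.≟ a | b F.≟ b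
... | yes b≡a | _      = ⊥-elim (a≢b (P.sym b≡a))
... | no _    | yes _  = P.refl
... | no _    | no b≢b = ⊥-elim (b≢b P.refl)

swapAt-minimal : ∀ {n} {a b k : Fin n} γ → k ≢ a → k ≢ b → swapAt a b γ k ≡ γ k
swapAt-minimal {a = a} {b} {k} γ k≢a k≢b with k F.≟ a | k F.≟ b
... | yes k≡a | _       = ⊥-elim (k≢a k≡a)
... | no _    | yes k≡b = ⊥-elim (k≢b k≡b)
... | no _    | no _    = P.refl

bump-swapAt-first : ∀ {n} {a b : Fin n} d e γ → a ≢ b → bump a d (bump b e (swapAt a b γ)) a ≡ γ b ℤ.+ d
bump-swapAt-first {a = a} {b} d e γ a≢b =
  P.trans (bump-updates {a = a} d (bump b e (swapAt a b γ)) P.refl)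
          (P.cong (ℤ._+ d) (P.trans (bump-minimal e (swapAt a b γ) a≢b) (swapAt-first a b γ)))

bump-swapAt-second : ∀ {n} {a b : Fin n} d e γ → a ≢ b → bump a d (bump b e (swapAt a b γ)) b ≡ γ a ℤ.+ e
bump-swapAt-second {a = a} {b} d e γ a≢b =
  P.trans (bump-minimal d (bump b e (swapAt a b γ)) (a≢b ∘ P.sym))
          (P.trans (bump-updates {a = b} e (swapAt a b γ) P.refl) (P.cong (ℤ._+ e) (swapAt-second γ a≢b)))

bump-swapAt-minimal : ∀ {n} {a b k : Fin n} d e γ → k ≢ a → k ≢ b → bump a d (bump b e (swapAt a b γ)) k ≡ γ k
bump-swapAt-minimal {a = a} {b} d e γ k≢a k≢b =
  P.trans (bump-minimal d (bump b e (swapAt a b γ)) k≢a)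
          (P.trans (bump-minimal e (swapAt a b γ) k≢b) (swapAt-minimal γ k≢a k≢b))

inject₁≢suc : ∀ {n} (i : Fin n) → inject₁ i ≢ suc i
inject₁≢suc i = FP.<⇒≢ (FP.≤̄⇒inject₁< FP.≤-refl)

punchIn-punchOut-comm : ∀ {m} (j c : Fin (suc (suc m))) (j≢c : j ≢ c) (c≢j : c ≢ j) →
                        punchIn j ∘ punchIn (punchOut j≢c) ≗ punchIn c ∘ punchIn (punchOut c≢j)
punchIn-punchOut-comm zero    zero    j≢c _ _ = ⊥-elim (j≢c P.refl)
punchIn-punchOut-comm zero    (suc c) _   _ _ = P.refl
punchIn-punchOut-comm (suc j) zero    _   _ _ = P.refl
punchIn-punchOut-comm {suc m} (suc j) (suc c) _ _ zero = P.refl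
punchIn-punchOut-comm {suc m} (suc j) (suc c) j≢c c≢j (suc b) =
  P.cong suc (punchIn-punchOut-comm j c (j≢c ∘ P.cong suc) (c≢j ∘ P.cong suc) b)

-- The determinant is defined inside G R h, so these lemmas carry the (unused) sequence h.
module Determinant {c ℓ} (R : CommutativeRing c ℓ) (h : ℕ → CommutativeRing.Carrier R) where
  open CommutativeRing R hiding (zero)
  open G R h using (det; sumFin; signR)
  open import Algebra.Properties.Semiring.Sum semiring
    using (sum; sum-cong-≋; ∑-distrib-+; ∑-comm; sum-remove; *-distribˡ-sum)
  open import Algebra.Properties.Ring ring using (-1*x≈-x; -‿distribˡ-*; -‿distribʳ-*)
  open import Algebra.Properties.AbelianGroup +-abelianGroup using (⁻¹-involutive; ε⁻¹≈ε)
  open import Algebra.Solver.Ring.NaturalCoefficients.Default commutativeSemiring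
    using (solve; _:=_; _:+_; _:*_)
  open import Relation.Binary.Reasoning.Setoid setoid

  Matrix : ℕ → Set c
  Matrix n = Fin n → Fin n → Carrier

  AgreeOffRow : ∀ {n} → Fin n → Matrix n → Matrix n → Set ℓ
  AgreeOffRow k A B = ∀ i → i ≢ k → ∀ j → A i j ≈ B i j

  minor : ∀ {n} → Matrix (suc n) → Fin (suc n) → Matrix n
  minor A j a b = A (suc a) (punchIn j b)

  sign : ∀ {n} → Fin n → Carrier
  sign j = signR (toℕ j)

  expansionTerm : ∀ {n} → Matrix (suc n) → Fin (suc n) → Carrier
  expansionTerm {n} A j = sign j * (A zero j * det n (minor A j))

  sumFin≡sum : ∀ n (f : Vector Carrier n) → sumFin n f ≡ sum f
  sumFin≡sum zero    f = P.refl
  sumFin≡sum (suc n) f = P.cong (λ s → f zero + s) (sumFin≡sum n (f ∘ suc))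

  det-expand : ∀ {n} (A : Matrix (suc n)) → det (suc n) A ≈ sum (expansionTerm A)
  det-expand {n} A = reflexive (sumFin≡sum (suc n) (expansionTerm A))

  ∑-neg : ∀ {n} (f : Vector Carrier n) → sum (λ j → - f j) ≈ - sum f
  ∑-neg f = begin
    sum (λ j → - f j)      ≈⟨ sum-cong-≋ (λ j → sym (-1*x≈-x (f j))) ⟩
    sum (λ j → - 1# * f j) ≈⟨ sym (*-distribˡ-sum (- 1#) f) ⟩
    - 1# * sum f           ≈⟨ -1*x≈-x (sum f) ⟩
    - sum f                ∎

  ∑-linear : ∀ {n} (f u v : Vector Carrier n) x y → (∀ j → f j ≈ x * u j + y * v j) →
             sum f ≈ x * sum u + y * sum v
  ∑-linear f u v x y f≈ = begin
    sum f                                       ≈⟨ sum-cong-≋ f≈ ⟩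
    sum (λ j → x * u j + y * v j)               ≈⟨ ∑-distrib-+ (λ j → x * u j) (λ j → y * v j) ⟩
    sum (λ j → x * u j) + sum (λ j → y * v j)   ≈⟨ sym (+-cong (*-distribˡ-sum x u) (*-distribˡ-sum y v)) ⟩
    x * sum u + y * sum v                       ∎

  det-cong : ∀ n {A B : Matrix n} → (∀ i j → A i j ≈ B i j) → det n A ≈ det n B
  det-cong zero    A≈B = refl
  det-cong (suc n) {A} {B} A≈B = begin
    det (suc n) A         ≈⟨ det-expand A ⟩
    sum (expansionTerm A) ≈⟨ sum-cong-≋ {x = expansionTerm A} {expansionTerm B} term ⟩
    sum (expansionTerm B) ≈⟨ det-expand B ⟨
    det (suc n) B         ∎
    where
    term : ∀ j → expansionTerm A j ≈ expansionTerm B j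
    term j = *-congˡ (*-cong (A≈B zero j) (det-cong n (λ a b → A≈B (suc a) (punchIn j b))))

  mutual
    det-rowLinear : ∀ n (k : Fin n) (A B M : Matrix n) x y → (∀ j → M k j ≈ x * A k j + y * B k j) →
                    AgreeOffRow k A M → AgreeOffRow k B M → det n M ≈ x * det n A + y * det n B
    det-rowLinear (suc n) k A B M x y rowₖ A≈M B≈M = begin
      det (suc n) M                                         ≈⟨ det-expand M ⟩
      sum (expansionTerm M)                                 ≈⟨ ∑-linear _ _ _ x y
                                                                 (expansionTerm-rowLinear n k A B M x y rowₖ A≈M B≈M) ⟩
      x * sum (expansionTerm A) + y * sum (expansionTerm B) ≈⟨ +-cong (*-congˡ (det-expand A)) (*-congˡ (det-expand B)) ⟨
      x * det (suc n) A + y * det (suc n) B                 ∎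

    expansionTerm-rowLinear : ∀ n (k : Fin (suc n)) (A B M : Matrix (suc n)) x y →
                              (∀ j → M k j ≈ x * A k j + y * B k j) → AgreeOffRow k A M → AgreeOffRow k B M →
                              ∀ j → expansionTerm M j ≈ x * expansionTerm A j + y * expansionTerm B j
    expansionTerm-rowLinear n zero A B M x y row₀ A≈M B≈M j = begin
      sign j * (M zero j * det n (minor M j))                     ≈⟨ *-congˡ (*-congʳ (row₀ j)) ⟩
      sign j * ((x * A zero j + y * B zero j) * det n (minor M j)) ≈⟨ distribute _ _ _ _ _ _ ⟩
      x * (sign j * (A zero j * det n (minor M j))) +
      y * (sign j * (B zero j * det n (minor M j)))               ≈⟨ +-cong (*-congˡ (*-congˡ (*-congˡ (minor≈ A≈M))))
                                                                             (*-congˡ (*-congˡ (*-congˡ (minor≈ B≈M)))) ⟨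
      x * expansionTerm A j + y * expansionTerm B j               ∎
      where
      minor≈ : ∀ {N} → AgreeOffRow zero N M → det n (minor N j) ≈ det n (minor M j)
      minor≈ N≈M = det-cong n (λ a b → N≈M (suc a) (λ ()) _)
      distribute : ∀ s x a y b m → s * ((x * a + y * b) * m) ≈ x * (s * (a * m)) + y * (s * (b * m))
      distribute = solve 6 (λ s x a y b m → s :* ((x :* a :+ y :* b) :* m)
                                           := x :* (s :* (a :* m)) :+ y :* (s :* (b :* m))) refl
    expansionTerm-rowLinear n (suc k) A B M x y rowₖ A≈M B≈M j = begin
      sign j * (M zero j * det n (minor M j))                          ≈⟨ *-congˡ (*-congʳ (sym (A≈M zero (λ ()) j))) ⟩
      sign j * (A zero j * det n (minor M j))                          ≈⟨ *-congˡ (*-congˡ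
                                                                            (det-rowLinear n k (minor A j) (minor B j) (minor M j) x y
                                                                              (rowₖ ∘ punchIn j)
                                                                              (λ i i≢k b → A≈M (suc i) (i≢k ∘ FP.suc-injective) _)
                                                                              (λ i i≢k b → B≈M (suc i) (i≢k ∘ FP.suc-injective) _))) ⟩
      sign j * (A zero j * (x * det n (minor A j) + y * det n (minor B j))) ≈⟨ distribute _ _ _ _ _ _ ⟩
      x * (sign j * (A zero j * det n (minor A j))) +
      y * (sign j * (A zero j * det n (minor B j)))                    ≈⟨ +-congˡ (*-congˡ (*-congˡ (*-congʳ
                                                                            (trans (A≈M zero (λ ()) j) (sym (B≈M zero (λ ()) j)))))) ⟩
      x * expansionTerm A j + y * expansionTerm B j                    ∎
      where
      distribute : ∀ s a x p y q → s * (a * (x * p + y * q)) ≈ x * (s * (a * p)) + y * (s * (a * q))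
      distribute = solve 6 (λ s a x p y q → s :* (a :* (x :* p :+ y :* q))
                                           := x :* (s :* (a :* p)) :+ y :* (s :* (a :* q))) refl

  sign-punchOut-antisym : ∀ {m} (j c : Fin (suc (suc m))) (j≢c : j ≢ c) (c≢j : c ≢ j) →
                   sign j * sign (punchOut j≢c) ≈ - (sign c * sign (punchOut c≢j))
  sign-punchOut-antisym zero zero j≢c _ = ⊥-elim (j≢c P.refl)
  sign-punchOut-antisym zero (suc c) _ _ =
    trans (*-identityˡ _) (trans (sym (⁻¹-involutive _)) (-‿cong (sym (*-identityʳ _))))
  sign-punchOut-antisym (suc j) zero _ _ = trans (*-identityʳ _) (-‿cong (sym (*-identityˡ _)))
  sign-punchOut-antisym {zero} (suc zero) (suc zero) j≢c _ = ⊥-elim (j≢c P.refl)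
  sign-punchOut-antisym {suc m} (suc j) (suc c) j≢c c≢j =
    trans (-x*-y≈x*y _ _) (trans (sign-punchOut-antisym j c (j≢c ∘ P.cong suc) (c≢j ∘ P.cong suc))
                                 (-‿cong (sym (-x*-y≈x*y _ _))))
    where
    -x*-y≈x*y : ∀ x y → - x * - y ≈ x * y
    -x*-y≈x*y x y = trans (sym (-‿distribˡ-* x (- y)))
                          (trans (-‿cong (sym (-‿distribʳ-* x y))) (⁻¹-involutive _))

  pairTerm : ∀ {m} → Matrix (suc (suc m)) → Fin (suc (suc m)) → Fin (suc m) → Carrier
  pairTerm {m} A j l = sign j * (A zero j * (sign l * (A (suc zero) (punchIn j l) * det m (minor (minor A j) l))))

  det-expand₂ : ∀ {m} (A : Matrix (suc (suc m))) → det (suc (suc m)) A ≈ sum (λ j → sum (pairTerm A j))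
  det-expand₂ {m} A = trans (det-expand A) (sum-cong-≋ λ j → begin
    sign j * (A zero j * det (suc m) (minor A j))  ≈⟨ *-congˡ (*-congˡ (det-expand (minor A j))) ⟩
    sign j * (A zero j * sum (term j))             ≈⟨ *-congˡ (*-distribˡ-sum (A zero j) (term j)) ⟩
    sign j * sum (λ l → A zero j * term j l)       ≈⟨ *-distribˡ-sum (sign j) (λ l → A zero j * term j l) ⟩
    sum (pairTerm A j)                             ∎)
    where
    term : Fin (suc (suc m)) → Fin (suc m) → Carrier
    term j = expansionTerm (minor A j)

  -- Pair terms indexed by the two distinct columns hit by rows 0 and 1, padded with zero on the
  -- diagonal; exchanging rows 0 and 1 then amounts to transposing this square array.
  offDiagonalTerm : ∀ {m} → Matrix (suc (suc m)) → Fin (suc (suc m)) → Fin (suc (suc m)) → Carrier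
  offDiagonalTerm A j c with j F.≟ c
  ... | yes _   = 0#
  ... | no j≢c = pairTerm A j (punchOut j≢c)

  offDiagonalTerm-sum : ∀ {m} (A : Matrix (suc (suc m))) j → sum (offDiagonalTerm A j) ≈ sum (pairTerm A j)
  offDiagonalTerm-sum A j = trans (sum-remove {i = j} (offDiagonalTerm A j))
    (trans (+-cong diagonal (sum-cong-≋ offDiagonal)) (+-identityˡ _))
    where
    diagonal : offDiagonalTerm A j j ≈ 0#
    diagonal with j F.≟ j
    ... | yes _  = refl
    ... | no j≢j = ⊥-elim (j≢j P.refl)
    offDiagonal : ∀ l → offDiagonalTerm A j (punchIn j l) ≈ pairTerm A j l
    offDiagonal l with j F.≟ punchIn j l
    ... | yes j≡ = ⊥-elim (FP.punchInᵢ≢i j l (P.sym j≡))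
    ... | no _   = reflexive (P.cong (pairTerm A j) (P.trans (FP.punchOut-cong j P.refl) (FP.punchOut-punchIn j)))

  offDiagonalTerm-swap₀₁ : ∀ {m} (A B : Matrix (suc (suc m))) →
                           (∀ j → B zero j ≈ A (suc zero) j) → (∀ j → B (suc zero) j ≈ A zero j) →
                           (∀ a j → B (suc (suc a)) j ≈ A (suc (suc a)) j) →
                           ∀ j c → offDiagonalTerm B j c ≈ - offDiagonalTerm A c j
  offDiagonalTerm-swap₀₁ {m} A B row₀ row₁ rows j c with j F.≟ c | c F.≟ j
  ... | yes _   | yes _   = sym ε⁻¹≈ε
  ... | yes j≡c | no c≢j  = ⊥-elim (c≢j (P.sym j≡c))
  ... | no j≢c  | yes c≡j = ⊥-elim (j≢c (P.sym c≡j))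
  ... | no j≢c  | no c≢j  = begin
    sign j * (B zero j * (sign l * (B (suc zero) (punchIn j l) * det _ (minor (minor B j) l))))
      ≈⟨ *-congˡ (*-cong (row₀ j) (*-congˡ (*-cong
           (trans (row₁ _) (reflexive (P.cong (A zero) (FP.punchIn-punchOut j≢c))))
           (det-cong _ (λ a b → trans (rows a _) (reflexive (P.cong (A (suc (suc a)))
                                                          (punchIn-punchOut-comm j c j≢c c≢j b)))))))) ⟩
    sign j * (A (suc zero) j * (sign l * (A zero c * D)))
      ≈⟨ regroup _ _ _ _ _ ⟩
    (sign j * sign l) * (A zero c * (A (suc zero) j * D))
      ≈⟨ *-congʳ (sign-punchOut-antisym j c j≢c c≢j) ⟩
    - (sign c * sign l′) * (A zero c * (A (suc zero) j * D))
      ≈⟨ -‿distribˡ-* _ _ ⟨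
    - ((sign c * sign l′) * (A zero c * (A (suc zero) j * D)))
      ≈⟨ -‿cong (ungroup _ _ _ _ _) ⟩
    - (sign c * (A zero c * (sign l′ * (A (suc zero) j * D))))
      ≈⟨ -‿cong (*-congˡ (*-congˡ (*-congˡ (*-congʳ
           (reflexive (P.cong (A (suc zero)) (P.sym (FP.punchIn-punchOut c≢j)))))))) ⟩
    - pairTerm A c l′
      ∎
    where
    l l′ : Fin (suc m)
    l = punchOut j≢c
    l′ = punchOut c≢j
    D : Carrier
    D = det m (minor (minor A c) l′)
    regroup : ∀ s a t b d → s * (a * (t * (b * d))) ≈ (s * t) * (b * (a * d))
    regroup = solve 5 (λ s a t b d → s :* (a :* (t :* (b :* d))) := (s :* t) :* (b :* (a :* d))) refl
    ungroup : ∀ s t b a d → (s * t) * (b * (a * d)) ≈ s * (b * (t * (a * d)))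
    ungroup = solve 5 (λ s t b a d → (s :* t) :* (b :* (a :* d)) := s :* (b :* (t :* (a :* d)))) refl

  det-swap₀₁ : ∀ m (A B : Matrix (suc (suc m))) →
               (∀ j → B zero j ≈ A (suc zero) j) → (∀ j → B (suc zero) j ≈ A zero j) →
               (∀ a j → B (suc (suc a)) j ≈ A (suc (suc a)) j) → det (suc (suc m)) B ≈ - det (suc (suc m)) A
  det-swap₀₁ m A B row₀ row₁ rows = begin
    det (suc (suc m)) B                                        ≈⟨ det-expand₂ B ⟩
    sum (λ j → sum (pairTerm B j))                             ≈⟨ sum-cong-≋ (λ j → offDiagonalTerm-sum B j) ⟨
    sum (λ j → sum (offDiagonalTerm B j))                      ≈⟨ sum-cong-≋ (λ j → sum-cong-≋
                                                                    (offDiagonalTerm-swap₀₁ A B row₀ row₁ rows j)) ⟩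
    sum (λ j → sum (λ c → - offDiagonalTerm A c j))            ≈⟨ sum-cong-≋ (λ j → ∑-neg (λ c → offDiagonalTerm A c j)) ⟩
    sum (λ j → - sum (λ c → offDiagonalTerm A c j))            ≈⟨ ∑-neg (λ j → sum (λ c → offDiagonalTerm A c j)) ⟩
    - sum (λ j → sum (λ c → offDiagonalTerm A c j))            ≈⟨ -‿cong (∑-comm (λ j c → offDiagonalTerm A c j)) ⟩
    - sum (λ c → sum (offDiagonalTerm A c))                    ≈⟨ -‿cong (sum-cong-≋ (offDiagonalTerm-sum A)) ⟩
    - sum (λ c → sum (pairTerm A c))                           ≈⟨ -‿cong (det-expand₂ A) ⟨
    - det (suc (suc m)) A                                      ∎

  det-swapAdjacent : ∀ n (k : Fin n) (A B : Matrix (suc n)) →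
                     (∀ j → B (inject₁ k) j ≈ A (suc k) j) → (∀ j → B (suc k) j ≈ A (inject₁ k) j) →
                     (∀ i → i ≢ inject₁ k → i ≢ suc k → ∀ j → B i j ≈ A i j) → det (suc n) B ≈ - det (suc n) A
  det-swapAdjacent (suc m) zero A B rowₖ rowₖ₊₁ rows =
    det-swap₀₁ m A B rowₖ rowₖ₊₁ (λ a → rows (suc (suc a)) (λ ()) (λ ()))
  det-swapAdjacent (suc n) (suc k) A B rowₖ rowₖ₊₁ rows = begin
    det (suc (suc n)) B             ≈⟨ det-expand B ⟩
    sum (expansionTerm B)           ≈⟨ sum-cong-≋ term ⟩
    sum (λ j → - expansionTerm A j) ≈⟨ ∑-neg (expansionTerm A) ⟩
    - sum (expansionTerm A)         ≈⟨ -‿cong (det-expand A) ⟨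
    - det (suc (suc n)) A           ∎
    where
    term : ∀ j → expansionTerm B j ≈ - expansionTerm A j
    term j = begin
      sign j * (B zero j * det (suc n) (minor B j))     ≈⟨ *-congˡ (*-cong (rows zero (λ ()) (λ ()) j)
                                                             (det-swapAdjacent n k (minor A j) (minor B j)
                                                               (rowₖ ∘ punchIn j) (rowₖ₊₁ ∘ punchIn j)
                                                               (λ i i≢k i≢k′ b → rows (suc i) (i≢k ∘ FP.suc-injective)
                                                                                            (i≢k′ ∘ FP.suc-injective) _))) ⟩
      sign j * (A zero j * - det (suc n) (minor A j))   ≈⟨ *-congˡ (-‿distribʳ-* _ _) ⟨
      sign j * - (A zero j * det (suc n) (minor A j))   ≈⟨ -‿distribʳ-* _ _ ⟨
      - expansionTerm A j                               ∎

module KMatrices {c ℓ} (R : CommutativeRing c ℓ) (h : ℕ → CommutativeRing.Carrier R) where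
  open CommutativeRing R hiding (zero)
  open G R h
  open Determinant R h using (Matrix; AgreeOffRow; det-cong; det-rowLinear; det-swapAdjacent)
  open import Algebra.Properties.Ring ring using (-1*x≈-x)
  open import Algebra.Properties.AbelianGroup +-abelianGroup using (ε⁻¹≈ε; xyx⁻¹≈y)
  open import Algebra.Properties.CommutativeSemigroup +-commutativeSemigroup using (interchange; x∙yz≈y∙xz)
  open import Relation.Binary.Reasoning.Setoid setoid

  natR-+ : ∀ a b → natR (a ℕ.+ b) ≈ natR a + natR b
  natR-+ zero    b = sym (+-identityˡ _)
  natR-+ (suc a) b = trans (+-congˡ (natR-+ a b)) (sym (+-assoc _ _ _))

  kCoeff : ℕ → ℕ → Carrier
  kCoeff r i = intR (binomℤ (+ r ℤ.+ + i ℤ.- + 1) i)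

  kCoeff-suc : ∀ r i → kCoeff (suc r) i ≡ natR ((r ℕ.+ i) C i)
  kCoeff-suc r i = P.cong intR (P.trans (P.cong (λ z → binomℤ z i) (+suc-1≡+ (r ℕ.+ i))) (binomℤ-ℕ (r ℕ.+ i) i))

  kCoeff-sucIndex : ∀ r i → kCoeff r (suc i) ≡ natR ((r ℕ.+ i) C suc i)
  kCoeff-sucIndex r i = P.cong intR (P.trans (P.cong (λ z → binomℤ z (suc i)) r+[1+i]-1≡r+i) (binomℤ-ℕ (r ℕ.+ i) (suc i)))
    where
    r+[1+i]-1≡r+i : + r ℤ.+ + suc i ℤ.- + 1 ≡ + (r ℕ.+ i)
    r+[1+i]-1≡r+i = P.trans (P.cong (λ t → + t ℤ.- + 1) (ℕP.+-suc r i)) (+suc-1≡+ (r ℕ.+ i))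

  kCoeff-pascal : ∀ r i → kCoeff (suc r) (suc i) ≈ kCoeff (suc r) i + kCoeff r (suc i)
  kCoeff-pascal r i = begin
    kCoeff (suc r) (suc i)                          ≡⟨ kCoeff-suc r (suc i) ⟩
    natR ((r ℕ.+ suc i) C suc i)                    ≡⟨ P.cong (λ t → natR (t C suc i)) (ℕP.+-suc r i) ⟩
    natR (suc (r ℕ.+ i) C suc i)                    ≡⟨ P.cong natR (nCk+nC[k+1]≡[n+1]C[k+1] (r ℕ.+ i) i) ⟨
    natR ((r ℕ.+ i) C i ℕ.+ (r ℕ.+ i) C suc i)      ≈⟨ natR-+ ((r ℕ.+ i) C i) ((r ℕ.+ i) C suc i) ⟩
    natR ((r ℕ.+ i) C i) + natR ((r ℕ.+ i) C suc i) ≡⟨ P.cong₂ _+_ (kCoeff-suc r i) (kCoeff-sucIndex r i) ⟨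
    kCoeff (suc r) i + kCoeff r (suc i)             ∎

  sumTo-cong : ∀ n {f g : ℕ → Carrier} → (∀ i → f i ≈ g i) → sumTo n f ≈ sumTo n g
  sumTo-cong zero    f≈g = f≈g 0
  sumTo-cong (suc n) f≈g = +-cong (sumTo-cong n f≈g) (f≈g (suc n))

  sumTo-+ : ∀ n (f g : ℕ → Carrier) → sumTo n (λ i → f i + g i) ≈ sumTo n f + sumTo n g
  sumTo-+ zero    f g = refl
  sumTo-+ (suc n) f g = trans (+-congʳ (sumTo-+ n f g)) (interchange _ _ _ _)

  sumTo-shift : ∀ n (f : ℕ → Carrier) → sumTo (suc n) f ≈ f 0 + sumTo n (f ∘ suc)
  sumTo-shift zero    f = refl
  sumTo-shift (suc n) f = trans (+-congʳ (sumTo-shift n f)) (+-assoc _ _ _)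

  convolve : (ℕ → Carrier) → (ℕ → Carrier) → ℕ → Carrier
  convolve u f K = sumTo K (λ i → u i * f (K ℕ.∸ i))

  convolve-partialSums : ∀ (u w f : ℕ → Carrier) → u 0 ≈ w 0 → (∀ i → u (suc i) ≈ u i + w (suc i)) →
                         ∀ K → convolve u f (suc K) ≈ convolve u f K + convolve w f (suc K)
  convolve-partialSums u w f u₀≈w₀ u-step K = begin
    convolve u f (suc K)                                              ≈⟨ sumTo-shift K _ ⟩
    u 0 * f (suc K) + sumTo K (λ i → u (suc i) * f (K ℕ.∸ i))         ≈⟨ +-cong (*-congʳ u₀≈w₀)
                                                                           (sumTo-cong K (λ i → trans (*-congʳ (u-step i)) (distribʳ _ _ _))) ⟩
    w 0 * f (suc K) + sumTo K (λ i → u i * f (K ℕ.∸ i) + w (suc i) * f (K ℕ.∸ i))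
                                                                      ≈⟨ +-congˡ (sumTo-+ K _ _) ⟩
    w 0 * f (suc K) + (convolve u f K + sumTo K (λ i → w (suc i) * f (K ℕ.∸ i)))
                                                                      ≈⟨ x∙yz≈y∙xz _ _ _ ⟩
    convolve u f K + (w 0 * f (suc K) + sumTo K (λ i → w (suc i) * f (K ℕ.∸ i)))
                                                                      ≈⟨ +-congˡ (sumTo-shift K _) ⟨
    convolve u f K + convolve w f (suc K)                             ∎

  -- kk (+ r) (+ m) unfolds to convolve (kCoeff r) h m.
  kk-pascal : ∀ r m → kk (+ suc r) m - kk (+ suc r) (m ℤ.- + 1) ≈ kk (+ r) m
  kk-pascal r -[1+ _ ]  = -‿inverseʳ 0#
  kk-pascal r (+ zero)  = trans (+-congˡ ε⁻¹≈ε) (+-identityʳ _)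
  kk-pascal r (+ suc m) rewrite +suc-1≡+ m =
    trans (+-congʳ (convolve-partialSums (kCoeff (suc r)) (kCoeff r) h refl (kCoeff-pascal r) m)) (xyx⁻¹≈y _ _)

  kMatrix : ∀ {n} → (Fin n → ℤ) → Matrix n
  kMatrix δ i j = kk (+ toℕ i) (δ i ℤ.+ + toℕ j ℤ.- + toℕ i)

  kMatrix-inject₁ : ∀ {n} (δ : Fin (suc n) → ℤ) (i : Fin n) j →
                    kMatrix δ (inject₁ i) j ≡ kk (+ toℕ i) (δ (inject₁ i) ℤ.+ + toℕ j ℤ.- + toℕ i)
  kMatrix-inject₁ δ i j = P.cong (λ t → kk (+ t) (δ (inject₁ i) ℤ.+ + toℕ j ℤ.- + t)) (FP.toℕ-inject₁ i)

  kMatrix-cong : ∀ {n} (δ δ′ : Fin n → ℤ) k → δ k ≡ δ′ k → ∀ j → kMatrix δ k j ≈ kMatrix δ′ k j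
  kMatrix-cong δ δ′ k δₖ≡δ′ₖ j = reflexive (P.cong (λ z → kk (+ toℕ k) (z ℤ.+ + toℕ j ℤ.- + toℕ k)) δₖ≡δ′ₖ)

  g-cong : ∀ {n} {δ δ′ : Fin n → ℤ} → δ ≗ δ′ → g δ ≈ g δ′
  g-cong {n} {δ} {δ′} δ≗δ′ = det-cong n (λ k → kMatrix-cong δ δ′ k (δ≗δ′ k))

  lowerRow : ∀ {n} → (Fin (suc n) → ℤ) → Fin n → Matrix (suc n)
  lowerRow δ i = updateAt (kMatrix δ) (suc i) (λ _ j → kk (+ toℕ i) (δ (suc i) ℤ.+ + toℕ j ℤ.- + toℕ (suc i)))

  g-sub-lowerRow : ∀ {n} (δ : Fin (suc n) → ℤ) (i : Fin n) →
                   g δ - g (bump (suc i) -[1+ 0 ] δ) ≈ det (suc n) (lowerRow δ i)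
  g-sub-lowerRow {n} δ i = begin
    g δ - g δ⁻                     ≈⟨ x-y≈1x+-1y _ _ ⟩
    1# * g δ + - 1# * g δ⁻         ≈⟨ det-rowLinear (suc n) (suc i) (kMatrix δ) (kMatrix δ⁻) (lowerRow δ i) 1# (- 1#)
                                        row kMatrix≈lowerRow kMatrix⁻≈lowerRow ⟨
    det (suc n) (lowerRow δ i)     ∎
    where
    δ⁻ : Fin (suc n) → ℤ
    δ⁻ = bump (suc i) -[1+ 0 ] δ
    x-y≈1x+-1y : ∀ x y → x - y ≈ 1# * x + - 1# * y
    x-y≈1x+-1y x y = sym (+-cong (*-identityˡ x) (-1*x≈-x y))
    row : ∀ j → lowerRow δ i (suc i) j ≈ 1# * kMatrix δ (suc i) j + - 1# * kMatrix δ⁻ (suc i) j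
    row j = begin
      lowerRow δ i (suc i) j                                 ≡⟨ P.cong (λ r → r j) (updateAt-updates (suc i) (kMatrix δ)) ⟩
      kk (+ toℕ i) m                                         ≈⟨ kk-pascal (toℕ i) m ⟨
      kk (+ suc (toℕ i)) m - kk (+ suc (toℕ i)) (m ℤ.- + 1) ≡⟨ P.cong (λ z → kk (+ suc (toℕ i)) m - kk (+ suc (toℕ i)) z)
                                                                  (P.trans (P.cong (λ z → z ℤ.+ + toℕ j ℤ.- + toℕ (suc i))
                                                                             (bump-updates -[1+ 0 ] δ P.refl))
                                                                           (lemma (δ (suc i)) (+ toℕ j) (+ toℕ (suc i)))) ⟨
      kMatrix δ (suc i) j - kMatrix δ⁻ (suc i) j             ≈⟨ x-y≈1x+-1y _ _ ⟩
      1# * kMatrix δ (suc i) j + - 1# * kMatrix δ⁻ (suc i) j ∎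
      where
      m : ℤ
      m = δ (suc i) ℤ.+ + toℕ j ℤ.- + toℕ (suc i)
      lemma : ∀ x y z → x ℤ.- + 1 ℤ.+ y ℤ.- z ≡ x ℤ.+ y ℤ.- z ℤ.- + 1
      lemma = ℤSolver.solve-∀
    kMatrix≈lowerRow : AgreeOffRow (suc i) (kMatrix δ) (lowerRow δ i)
    kMatrix≈lowerRow k k≢ j = reflexive (P.cong (λ r → r j) (P.sym (updateAt-minimal k (suc i) (kMatrix δ) k≢)))
    kMatrix⁻≈lowerRow : AgreeOffRow (suc i) (kMatrix δ⁻) (lowerRow δ i)
    kMatrix⁻≈lowerRow k k≢ j = trans (kMatrix-cong δ⁻ δ k (bump-minimal -[1+ 0 ] δ k≢) j) (kMatrix≈lowerRow k k≢ j)

  lowerRow-swap : ∀ {n} (δ δ′ : Fin (suc n) → ℤ) (i : Fin n) →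
                  δ′ (inject₁ i) ≡ δ (suc i) ℤ.- + 1 → δ′ (suc i) ≡ δ (inject₁ i) ℤ.+ + 1 →
                  (∀ k → k ≢ inject₁ i → k ≢ suc i → δ′ k ≡ δ k) →
                  det (suc n) (lowerRow δ′ i) ≈ - det (suc n) (lowerRow δ i)
  lowerRow-swap {n} δ δ′ i δ′a δ′b δ′ₖ = det-swapAdjacent n i (lowerRow δ i) (lowerRow δ′ i) rowa rowb rows
    where
    a b : Fin (suc n)
    a = inject₁ i
    b = suc i
    r : ℕ
    r = toℕ i
    a≢b : a ≢ b
    a≢b = inject₁≢suc i
    rowa : ∀ j → lowerRow δ′ i a j ≈ lowerRow δ i b j
    rowa j = begin
      lowerRow δ′ i a j                    ≡⟨ P.cong (λ row → row j) (updateAt-minimal a b (kMatrix δ′) a≢b) ⟩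
      kMatrix δ′ a j                       ≡⟨ kMatrix-inject₁ δ′ i j ⟩
      kk (+ r) (δ′ a ℤ.+ + toℕ j ℤ.- + r)  ≡⟨ P.cong (λ z → kk (+ r) (z ℤ.+ + toℕ j ℤ.- + r)) δ′a ⟩
      kk (+ r) (δ b ℤ.- + 1 ℤ.+ + toℕ j ℤ.- + r)
                                           ≡⟨ P.cong (kk (+ r)) (lemma (δ b) (+ toℕ j) (+ r)) ⟩
      kk (+ r) (δ b ℤ.+ + toℕ j ℤ.- + suc r) ≡⟨ P.cong (λ row → row j) (updateAt-updates b (kMatrix δ)) ⟨
      lowerRow δ i b j                     ∎
      where
      lemma : ∀ x y z → x ℤ.- + 1 ℤ.+ y ℤ.- z ≡ x ℤ.+ y ℤ.- (+ 1 ℤ.+ z)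
      lemma = ℤSolver.solve-∀
    rowb : ∀ j → lowerRow δ′ i b j ≈ lowerRow δ i a j
    rowb j = begin
      lowerRow δ′ i b j                    ≡⟨ P.cong (λ row → row j) (updateAt-updates b (kMatrix δ′)) ⟩
      kk (+ r) (δ′ b ℤ.+ + toℕ j ℤ.- + suc r) ≡⟨ P.cong (λ z → kk (+ r) (z ℤ.+ + toℕ j ℤ.- + suc r)) δ′b ⟩
      kk (+ r) (δ a ℤ.+ + 1 ℤ.+ + toℕ j ℤ.- + suc r)
                                           ≡⟨ P.cong (kk (+ r)) (lemma (δ a) (+ toℕ j) (+ r)) ⟩
      kk (+ r) (δ a ℤ.+ + toℕ j ℤ.- + r)   ≡⟨ kMatrix-inject₁ δ i j ⟨
      kMatrix δ a j                        ≡⟨ P.cong (λ row → row j) (updateAt-minimal a b (kMatrix δ) a≢b) ⟨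
      lowerRow δ i a j                     ∎
      where
      lemma : ∀ x y z → x ℤ.+ + 1 ℤ.+ y ℤ.- (+ 1 ℤ.+ z) ≡ x ℤ.+ y ℤ.- z
      lemma = ℤSolver.solve-∀
    rows : ∀ k → k ≢ a → k ≢ b → ∀ j → lowerRow δ′ i k j ≈ lowerRow δ i k j
    rows k k≢a k≢b j = begin
      lowerRow δ′ i k j ≡⟨ P.cong (λ row → row j) (updateAt-minimal k b (kMatrix δ′) k≢b) ⟩
      kMatrix δ′ k j    ≈⟨ kMatrix-cong δ′ δ k (δ′ₖ k k≢a k≢b) j ⟩
      kMatrix δ k j     ≡⟨ P.cong (λ row → row j) (updateAt-minimal k b (kMatrix δ) k≢b) ⟨
      lowerRow δ i k j  ∎

proposition3p2 : ∀ {c ℓr} (R : CommutativeRing c ℓr) (h : ℕ → CommutativeRing.Carrier R)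
                 → CommutativeRing._≈_ R (h 0) (CommutativeRing.1# R)
                 → (ℓ′ : ℕ) (γ : Fin (suc ℓ′) → ℤ) (i : Fin ℓ′)
                 → let open CommutativeRing R
                       open G R h
                       a = inject₁ i
                       b = suc i
                       sγ = swapAt a b γ
                   in g γ - g (bump b -[1+ 0 ] γ)
                      ≈ g (bump a -[1+ 0 ] sγ) - g (bump a -[1+ 0 ] (bump b (+ 1) sγ))
proposition3p2 R h _ ℓ′ γ i = begin
  g γ - g (bump b -[1+ 0 ] γ)      ≈⟨ g-sub-lowerRow γ i ⟩
  det (suc ℓ′) (lowerRow γ i)      ≈⟨ ⁻¹-involutive _ ⟨
  - - det (suc ℓ′) (lowerRow γ i)  ≈⟨ -‿cong (lowerRow-swap γ δ i δ-first δ-second δ-minimal) ⟨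
  - det (suc ℓ′) (lowerRow δ i)    ≈⟨ -‿cong (g-sub-lowerRow δ i) ⟨
  - (g δ - g (bump b -[1+ 0 ] δ))  ≈⟨ -‿cong (+-congˡ (-‿cong (g-cong (bump-conjugate a b (+ 1) -[1+ 0 ] sγ)))) ⟩
  - (g δ - g (bump a -[1+ 0 ] sγ)) ≈⟨ ⁻¹-anti-homo‿- _ _ ⟩
  g (bump a -[1+ 0 ] sγ) - g δ     ∎
  where
  open CommutativeRing R
  open G R h
  open KMatrices R h
  open import Algebra.Properties.AbelianGroup +-abelianGroup using (⁻¹-involutive; ⁻¹-anti-homo‿-)
  open import Relation.Binary.Reasoning.Setoid setoid
  a b : Fin (suc ℓ′)
  a = inject₁ i
  b = suc i
  a≢b : a ≢ b
  a≢b = inject₁≢suc i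
  sγ δ : Fin (suc ℓ′) → ℤ
  sγ = swapAt a b γ
  δ = bump a -[1+ 0 ] (bump b (+ 1) sγ)
  δ-first : δ a ≡ γ b ℤ.- + 1
  δ-first = bump-swapAt-first -[1+ 0 ] (+ 1) γ a≢b
  δ-second : δ b ≡ γ a ℤ.+ + 1
  δ-second = bump-swapAt-second -[1+ 0 ] (+ 1) γ a≢b
  δ-minimal : ∀ k → k ≢ a → k ≢ b → δ k ≡ γ k
  δ-minimal _ = bump-swapAt-minimal -[1+ 0 ] (+ 1) γ
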